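{- Let $D$ be a negative integer, $K=\mathbb{Q}(\sqrt{D})$, and let $A:K\to M_2(\mathbb{Q})$ be the map $A(a+b\sqrt{D})=a\,\mathrm{Id}+b\,A_D$ for $a,b\in\mathbb{Q}$, where $A_D=\begin{pmatrix}0&D\\1&0\end{pmatrix}$. Let $M=(m_{st})$ and $\tilde M=(\tilde m_{st})$ be $e\times r$ matrices with entries in $K$ ($s=1,\dots,e$, $t=1,\dots,r$), and suppose $M$ has rank $r$. Let $B$ be a $2\times2$ integer matrix with $\det B<0$. Then the $2e\times 2r$ matrix $\hat M$ with rational entries defined blockwise by $$\hat M_{st}=A(m_{st})+A(\tilde m_{st})B$$ has rank at least $r$.
   Context: In the paper the map $A$ arises from the action of complex multiplication (or a formal such action) on a period lattice, normalized so that $A(\sqrt{D})=A_D$; as a map $K\to M_2(\mathbb{Q})$ it is exactly the ring embedding stated in the claim. -}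

module Defs where

open import Data.Nat using (ℕ; zero; suc)
open import Data.Fin using (Fin; zero; suc)
open import Data.Product using (_×_; _,_; proj₁; proj₂)
open import Data.Integer as ℤ using (ℤ)
open import Data.Rational using (ℚ; 0ℚ; 1ℚ; _+_; _*_; _/_)
open import Relation.Binary.PropositionalEquality using (_≡_)

ℤtoℚ : ℤ → ℚ
ℤtoℚ z = z / 1

Σℚ : (n : ℕ) → (Fin n → ℚ) → ℚ
Σℚ zero    f = 0ℚ
Σℚ (suc n) f = f zero + Σℚ n (λ i → f (suc i))

-- K = ℚ(√D): the element a + b√D is represented by the pair (a , b)
K : Set
K = ℚ × ℚ

0K : K
0K = 0ℚ , 0ℚ

mulK : ℤ → K → K → K
mulK D (a , b) (c , d) = (a * c + ℤtoℚ D * (b * d)) , (a * d + b * c)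

addK : K → K → K
addK (a , b) (c , d) = (a + c) , (b + d)

ΣK : (n : ℕ) → (Fin n → K) → K
ΣK zero    f = 0K
ΣK (suc n) f = addK (f zero) (ΣK n (λ i → f (suc i)))

Mat : Set → ℕ → ℕ → Set
Mat X m n = Fin m → Fin n → X

Id₂ : Mat ℚ 2 2
Id₂ zero    zero    = 1ℚ
Id₂ (suc zero) (suc zero) = 1ℚ
Id₂ _ _ = 0ℚ

A-D : ℤ → Mat ℚ 2 2
A-D D zero       zero       = 0ℚ
A-D D zero       (suc zero) = ℤtoℚ D
A-D D (suc zero) zero       = 1ℚ
A-D D (suc zero) (suc zero) = 0ℚ

scale₂ : ℚ → Mat ℚ 2 2 → Mat ℚ 2 2
scale₂ c X i j = c * X i j

add₂ : Mat ℚ 2 2 → Mat ℚ 2 2 → Mat ℚ 2 2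
add₂ X Y i j = X i j + Y i j

mul₂ : Mat ℚ 2 2 → Mat ℚ 2 2 → Mat ℚ 2 2
mul₂ X Y i j = Σℚ 2 (λ k → X i k * Y k j)

A : ℤ → K → Mat ℚ 2 2
A D (a , b) = add₂ (scale₂ a Id₂) (scale₂ b (A-D D))

toℚMat : Mat ℤ 2 2 → Mat ℚ 2 2
toℚMat B i j = ℤtoℚ (B i j)

det₂ : Mat ℤ 2 2 → ℤ
det₂ B = B zero zero ℤ.* B (suc zero) (suc zero) ℤ.- B zero (suc zero) ℤ.* B (suc zero) zero

Mhat : ℤ → {e r : ℕ} → Mat K e r → Mat K e r → Mat ℤ 2 2
     → Fin e × Fin 2 → Fin r × Fin 2 → ℚ
Mhat D M M~ B (s , i) (t , j) =
  add₂ (A D (M s t)) (mul₂ (A D (M~ s t)) (toℚMat B)) i j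

-- Rank of a K-matrix equals the number of columns: the columns are K-linearly independent.
HasFullColumnRankK : ℤ → {e r : ℕ} → Mat K e r → Set
HasFullColumnRankK D {e} {r} M =
  (x : Fin r → K) → (∀ s → ΣK r (λ t → mulK D (M s t) (x t)) ≡ 0K) → ∀ t → x t ≡ 0K

-- rank ≥ k for a rational matrix with row index set R and column index set C:
-- there are k distinct columns which are ℚ-linearly independent.
RankAtLeast : {R C : Set} → (R → C → ℚ) → ℕ → Set
RankAtLeast {R} {C} N k =
  Σ' (Fin k → C) (λ c →
    ((j j' : Fin k) → c j ≡ c j' → j ≡ j') ×
    ((y : Fin k → ℚ) → (∀ ρ → Σℚ k (λ j → N ρ (c j) * y j) ≡ 0ℚ) → ∀ j → y j ≡ 0ℚ))
  where
  open import Data.Product using () renaming (Σ to Σ')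

-- Let δ = det B, G = adj(B) A_D B (so that B G = δ A_D B) and Λ = G − δ A_D.  Cut a coefficient
-- vector q ∈ ℚ^{2r} into blocks w_t ∈ K.  Block row s of M̂ q is Σ_t (m_st w_t + m̃_st B w_t), and
-- block row s of M̂ (I ⊗ G) q − δ√D M̂ q is Σ_t m_st Λ w_t.  Hence if both M̂ and M̂ (I ⊗ G) kill q,
-- full column rank of M gives Λ w_t = 0, and so q = 0, because for B = (a b; c d)
-- det Λ = −δ((b + Dc)² − D(a + d)² + 4Dδ), which is nonzero when D < 0 and δ < 0.  So if k columns
-- of M̂ form a basis of its column space, the 2r columns of M̂ stacked on M̂ (I ⊗ G) are independent
-- vectors with coordinates in ℚ^{2k}, whence r ≤ k.

module Submission where

open import Defs
open import Data.Nat using (ℕ)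
open import Data.Integer using (ℤ; _<_; 0ℤ)

open import Algebra.Bundles using (CommutativeRing)
open import Data.Empty using (⊥-elim)
open import Data.Fin as Fin using (Fin; zero; suc; punchIn; punchOut; _↑ˡ_; _↑ʳ_; combine; remQuot)
import Data.Fin.Properties as Finₚ
import Data.Integer as ℤ
open import Data.Integer using (-[1+_]; +[1+_])
import Data.Integer.Properties as ℤₚ
open import Data.Nat as ℕ using (zero; suc; z≤n; s≤s; _≤_)
import Data.Nat.Properties as ℕₚ
open import Data.Product using (∃; _×_; _,_; proj₁; proj₂; uncurry)
open import Data.Rational as ℚ using (ℚ; 0ℚ; 1ℚ; _+_; _*_; -_; _-_; 1/_)
import Data.Rational.Properties as ℚₚ
open import Data.Rational.Solver using (module +-*-Solver)
open import Data.Rational.Unnormalised as ℚᵘ using (mkℚᵘ; *≡*) renaming (_≃_ to _≃ᵘ_)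
import Data.Rational.Unnormalised.Properties as ℚᵘₚ
open import Data.Sum using (_⊎_; inj₁; inj₂)
open import Data.Vec.Functional using (Vector; _∷_; []; _++_; insertAt)
import Data.Vec.Functional.Properties as Vecₚ
open import Function using (_∘_; const)
open import Function.Definitions using (Injective)
open import Relation.Binary.PropositionalEquality
open import Relation.Nullary using (yes; no; ¬?)
open import Relation.Nullary.Decidable using (decidable-stable)

open import Algebra.Properties.CommutativeMonoid.Sum ℚₚ.+-0-commutativeMonoid
  using (sum; sum-syntax; sum-cong-≗; sum-replicate-zero; ∑-distrib-+; ∑-comm; sum-remove)
open import Algebra.Properties.Semiring.Sum (CommutativeRing.semiring ℚₚ.+-*-commutativeRing)
  using (*-distribˡ-sum; *-distribʳ-sum)
open +-*-Solver

Null : ∀ {n} → Vector ℚ n → Set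
Null v = ∀ i → v i ≡ 0ℚ

solve-linear : ∀ a x s .{{_ : ℚ.NonZero a}} → a * x + s ≡ 0ℚ → x ≡ - (1/ a) * s
solve-linear a x s ax+s≡0 = begin
  x
    ≡⟨ solve 4 (λ a x s π → x := x :* (con 1ℚ :- π :* a) :+ π :* (a :* x :+ s) :+ :- π :* s) refl a x s π ⟩
  x * (1ℚ - π * a) + π * (a * x + s) + - π * s
    ≡⟨ cong₂ (λ u v → x * (1ℚ - u) + π * v + - π * s) (ℚₚ.*-inverseˡ a) ax+s≡0 ⟩
  x * (1ℚ - 1ℚ) + π * 0ℚ + - π * s
    ≡⟨ solve 3 (λ x π s → x :* (con 1ℚ :- con 1ℚ) :+ π :* con 0ℚ :+ :- π :* s := :- π :* s) refl x π s ⟩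
  - π * s
    ∎
  where
  open ≡-Reasoning
  π = 1/ a

*-cancelˡ-nonzero : ∀ x y → x ≢ 0ℚ → x * y ≡ 0ℚ → y ≡ 0ℚ
*-cancelˡ-nonzero x y x≢0 xy≡0 =
  trans (solve-linear x y 0ℚ (trans (ℚₚ.+-identityʳ (x * y)) xy≡0)) (ℚₚ.*-zeroʳ (- (1/ x)))
  where
  instance
    x-nonZero : ℚ.NonZero x
    x-nonZero = ℚ.≢-nonZero x≢0

sum-null : ∀ {n} {f : Vector ℚ n} → Null f → sum f ≡ 0ℚ
sum-null {n} f≗0 = trans (sum-cong-≗ f≗0) (sum-replicate-zero n)

sum-↑ : ∀ m {n} (f : Vector ℚ (m ℕ.+ n)) → sum f ≡ sum (f ∘ (_↑ˡ n)) + sum (f ∘ (m ↑ʳ_))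
sum-↑ zero    f = sym (ℚₚ.+-identityˡ (sum f))
sum-↑ (suc m) f = trans (cong (f zero +_) (sum-↑ m (f ∘ suc))) (sym (ℚₚ.+-assoc (f zero) _ _))

sum-combine : ∀ m {n} (f : Vector ℚ (m ℕ.* n)) → sum f ≡ ∑[ t < m ] ∑[ j < n ] f (combine t j)
sum-combine zero        f = refl
sum-combine (suc m) {n} f =
  trans (sum-↑ n f) (cong (sum (f ∘ (_↑ˡ m ℕ.* n)) +_) (sum-combine m (f ∘ (n ↑ʳ_))))

Σℚ≡sum : ∀ n (f : Vector ℚ n) → Σℚ n f ≡ sum f
Σℚ≡sum zero    f = refl
Σℚ≡sum (suc n) f = cong (f zero +_) (Σℚ≡sum n (f ∘ suc))

-- Linear algebra over ℚ

Fam : ℕ → ℕ → Set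
Fam n m = Fin n → Vector ℚ m

lin : ∀ {n m} → Fam n m → Vector ℚ n → Vector ℚ m
lin {n} v c i = ∑[ j < n ] (v j i * c j)

Independent : ∀ {n m} → Fam n m → Set
Independent v = ∀ c → Null (lin v c) → Null c

Dependent : ∀ {n m} → Fam n m → Set
Dependent v = ∃ λ c → Null (lin v c) × ∃ λ j → c j ≢ 0ℚ

lin-cong : ∀ {n m} (v : Fam n m) {c c′} → c ≗ c′ → lin v c ≗ lin v c′
lin-cong v c≗c′ i = sum-cong-≗ (λ j → cong (v j i *_) (c≗c′ j))

lin-null : ∀ {n m} (v : Fam n m) {c} → Null c → Null (lin v c)
lin-null v c≗0 i = sum-null (λ j → trans (cong (v j i *_) (c≗0 j)) (ℚₚ.*-zeroʳ (v j i)))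

lin-scale : ∀ {n m} (v : Fam n m) a c i → lin v (λ j → a * c j) i ≡ a * lin v c i
lin-scale v a c i =
  trans (sum-cong-≗ (λ j → solve 3 (λ x a c → x :* (a :* c) := a :* (x :* c)) refl (v j i) a (c j)))
        (sym (*-distribˡ-sum a (λ j → v j i * c j)))

lin-assoc : ∀ {n k m} (V : Fam n m) (W : Fam k m) (L : Fam n k) →
            (∀ c → V c ≗ lin W (L c)) → ∀ q → lin V q ≗ lin W (lin L q)
lin-assoc {n} {k} V W L V≗WL q i = begin
  ∑[ c < n ] (V c i * q c)
    ≡⟨ sum-cong-≗ (λ c → cong (_* q c) (V≗WL c i)) ⟩
  ∑[ c < n ] (lin W (L c) i * q c)
    ≡⟨ sum-cong-≗ (λ c → trans (*-distribʳ-sum (q c) (λ a → W a i * L c a))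
                               (sum-cong-≗ (λ a → ℚₚ.*-assoc (W a i) (L c a) (q c)))) ⟩
  ∑[ c < n ] ∑[ a < k ] (W a i * (L c a * q c))
    ≡⟨ ∑-comm (λ c a → W a i * (L c a * q c)) ⟩
  ∑[ a < k ] ∑[ c < n ] (W a i * (L c a * q c))
    ≡⟨ sum-cong-≗ (λ a → *-distribˡ-sum (W a i) (λ c → L c a * q c)) ⟨
  lin W (lin L q) i
    ∎
  where open ≡-Reasoning

insertAt-≗ : ∀ {n} {A : Set} (c : Vector A n) p x (d : Vector A (suc n)) →
             x ≡ d p → c ≗ d ∘ punchIn p → insertAt c p x ≗ d
insertAt-≗ c p x d x≡dp c≗d k with k Fin.≟ p
... | yes refl = trans (Vecₚ.insertAt-lookup c p x) x≡dp
... | no k≢p   = begin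
  insertAt c p x k                          ≡⟨ cong (insertAt c p x) (Finₚ.punchIn-punchOut p≢k) ⟨
  insertAt c p x (punchIn p (punchOut p≢k)) ≡⟨ Vecₚ.insertAt-punchIn c p x (punchOut p≢k) ⟩
  c (punchOut p≢k)                          ≡⟨ c≗d (punchOut p≢k) ⟩
  d (punchIn p (punchOut p≢k))              ≡⟨ cong d (Finₚ.punchIn-punchOut p≢k) ⟩
  d k                                       ∎
  where
  open ≡-Reasoning
  p≢k = k≢p ∘ sym

module Pivot {m n} (v : Fam (suc n) (suc m)) (p : Fin (suc n)) (vp≢0 : v p zero ≢ 0ℚ) where

  private instance
    vp-nonZero : ℚ.NonZero (v p zero)
    vp-nonZero = ℚ.≢-nonZero vp≢0

  others : Fam n (suc m)
  others = v ∘ punchIn p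

  π : ℚ
  π = 1/ v p zero

  reduced : Fam n m
  reduced j i = others j (suc i) - π * others j zero * v p (suc i)

  lift : Vector ℚ n → Vector ℚ (suc n)
  lift c = insertAt c p (- π * lin others c zero)

  lin-pivot : ∀ c i → lin v c i ≡ v p i * c p + lin others (c ∘ punchIn p) i
  lin-pivot c i = sum-remove {i = p} (λ k → v k i * c k)

  lin-lift : ∀ c i → lin v (lift c) i ≡ v p i * (- π * lin others c zero) + lin others c i
  lin-lift c i = trans (lin-pivot (lift c) i)
    (cong₂ (λ x y → v p i * x + y) (Vecₚ.insertAt-lookup c p _) (lin-cong others (Vecₚ.insertAt-punchIn c p _) i))

  lin-lift-zero : ∀ c → lin v (lift c) zero ≡ 0ℚ
  lin-lift-zero c = begin
    lin v (lift c) zero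
      ≡⟨ lin-lift c zero ⟩
    v p zero * (- π * s) + s
      ≡⟨ solve 3 (λ a π s → a :* (:- π :* s) :+ s := s :* (con 1ℚ :- π :* a)) refl (v p zero) π s ⟩
    s * (1ℚ - π * v p zero)
      ≡⟨ cong (λ x → s * (1ℚ - x)) (ℚₚ.*-inverseˡ (v p zero)) ⟩
    s * (1ℚ - 1ℚ)
      ≡⟨ solve 1 (λ s → s :* (con 1ℚ :- con 1ℚ) := con 0ℚ) refl s ⟩
    0ℚ
      ∎
    where
    open ≡-Reasoning
    s = lin others c zero

  lin-reduced : ∀ c i → lin reduced c i ≡ lin others c (suc i) + - (π * v p (suc i)) * lin others c zero
  lin-reduced c i = begin
    lin reduced c i
      ≡⟨ sum-cong-≗ (λ j → solve 5 (λ x a π w c → (x :- π :* a :* w) :* c := x :* c :+ :- (π :* w) :* (a :* c))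
                                     refl (others j (suc i)) (others j zero) π w (c j)) ⟩
    ∑[ j < n ] (others j (suc i) * c j + - (π * w) * (others j zero * c j))
      ≡⟨ ∑-distrib-+ (λ j → others j (suc i) * c j) _ ⟩
    lin others c (suc i) + ∑[ j < n ] (- (π * w) * (others j zero * c j))
      ≡⟨ cong (lin others c (suc i) +_) (*-distribˡ-sum (- (π * w)) (λ j → others j zero * c j)) ⟨
    lin others c (suc i) + - (π * w) * lin others c zero
      ∎
    where
    open ≡-Reasoning
    w = v p (suc i)

  lin-lift-suc : ∀ c i → lin v (lift c) (suc i) ≡ lin reduced c i
  lin-lift-suc c i = trans (lin-lift c (suc i)) (trans
    (solve 4 (λ w π s l → w :* (:- π :* s) :+ l := l :+ :- (π :* w) :* s) refl
       (v p (suc i)) π (lin others c zero) (lin others c (suc i)))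
    (sym (lin-reduced c i)))

  lift-restrict : ∀ c → lin v c zero ≡ 0ℚ → lift (c ∘ punchIn p) ≗ c
  lift-restrict c v·c≡0 = insertAt-≗ (c ∘ punchIn p) p _ c
    (sym (solve-linear (v p zero) (c p) _ (trans (sym (lin-pivot c zero)) v·c≡0))) (λ _ → refl)

  lift-null : ∀ {c} → Null c → Null (lift c)
  lift-null {c} c≗0 = insertAt-≗ c p _ (const 0ℚ)
    (trans (cong (- π *_) (lin-null others c≗0 zero)) (ℚₚ.*-zeroʳ (- π))) c≗0

  dependent : Dependent reduced → Dependent v
  dependent (c , reduced·c≗0 , j , cj≢0) =
    lift c , v·lift≗0 , punchIn p j , cj≢0 ∘ trans (sym (Vecₚ.insertAt-punchIn c p _ j))
    where
    v·lift≗0 : Null (lin v (lift c))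
    v·lift≗0 zero    = lin-lift-zero c
    v·lift≗0 (suc i) = trans (lin-lift-suc c i) (reduced·c≗0 i)

  independent : Independent reduced → Independent v
  independent reduced-ind c v·c≗0 k = trans (sym (lift-restrict c (v·c≗0 zero) k)) (lift-null c′≗0 k)
    where
    c′ = c ∘ punchIn p
    c′≗0 : Null c′
    c′≗0 = reduced-ind c′ λ i → begin
      lin reduced c′ i        ≡⟨ lin-lift-suc c′ i ⟨
      lin v (lift c′) (suc i) ≡⟨ lin-cong v (lift-restrict c (v·c≗0 zero)) (suc i) ⟩
      lin v c (suc i)         ≡⟨ v·c≗0 (suc i) ⟩
      0ℚ                      ∎
      where open ≡-Reasoning

dependent⊎independent : ∀ m n (v : Fam n m) → Dependent v ⊎ (Independent v × n ≤ m)
dependent⊎independent m       zero    v = inj₂ ((λ _ _ ()) , z≤n)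
dependent⊎independent zero    (suc n) v = inj₁ (const 1ℚ , (λ ()) , zero , ℚₚ.1≢0)
dependent⊎independent (suc m) (suc n) v with Finₚ.any? (λ j → ¬? (v j zero ℚₚ.≟ 0ℚ))
... | yes (p , vp≢0) with dependent⊎independent m n (Pivot.reduced v p vp≢0)
...   | inj₁ dep         = inj₁ (Pivot.dependent v p vp≢0 dep)
...   | inj₂ (ind , n≤m) = inj₂ (Pivot.independent v p vp≢0 ind , s≤s n≤m)
dependent⊎independent (suc m) (suc n) v | no no-pivot with dependent⊎independent m (suc n) (λ j → v j ∘ suc)
...   | inj₁ (c , tail·c≗0 , dep) = inj₁ (c , v·c≗0 , dep)
  where
  head≡0 : ∀ j → v j zero ≡ 0ℚ
  head≡0 j = decidable-stable (v j zero ℚₚ.≟ 0ℚ) (λ vj≢0 → no-pivot (j , vj≢0))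
  v·c≗0 : Null (lin v c)
  v·c≗0 zero    = sum-null (λ j → trans (cong (_* c j) (head≡0 j)) (ℚₚ.*-zeroˡ (c j)))
  v·c≗0 (suc i) = tail·c≗0 i
...   | inj₂ (ind , n≤m) = inj₂ ((λ c v·c≗0 → ind c (v·c≗0 ∘ suc)) , ℕₚ.m≤n⇒m≤1+n n≤m)

independent⇒≤ : ∀ {n m} (v : Fam n m) → Independent v → n ≤ m
independent⇒≤ {n} {m} v ind with dependent⊎independent m n v
... | inj₁ (c , v·c≗0 , j , cj≢0) = ⊥-elim (cj≢0 (ind c v·c≗0 j))
... | inj₂ (_ , n≤m)              = n≤m

record Basis {n m} (v : Fam n m) : Set where
  field
    rank        : ℕ
    index       : Fin rank → Fin n
    injective   : Injective _≡_ _≡_ index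
    independent : Independent (v ∘ index)
    coordinates : Fam n rank
    spans       : ∀ c → v c ≗ lin (v ∘ index) (coordinates c)

module Extend {m n} (v : Fam (suc n) m) (b : Basis (v ∘ suc)) where
  open Basis b

  candidates : Fam (suc rank) m
  candidates = v ∘ (zero ∷ suc ∘ index)

  adjoin : Independent candidates → Basis v
  adjoin ind = record
    { rank        = suc rank
    ; index       = zero ∷ suc ∘ index
    ; injective   = λ {a} {b} → index′-injective a b
    ; independent = ind
    ; coordinates = coordinates′
    ; spans       = spans′
    }
    where
    index′-injective : ∀ a b → (zero ∷ suc ∘ index) a ≡ (zero ∷ suc ∘ index) b → a ≡ b
    index′-injective zero    zero    _  = refl
    index′-injective zero    (suc b) ()
    index′-injective (suc a) zero    ()
    index′-injective (suc a) (suc b) eq = cong suc (injective (Finₚ.suc-injective eq))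
    coordinates′ : Fam (suc n) (suc rank)
    coordinates′ zero    = 1ℚ ∷ const 0ℚ
    coordinates′ (suc c) = 0ℚ ∷ coordinates c
    spans′ : ∀ c → v c ≗ lin candidates (coordinates′ c)
    spans′ zero    i = sym (trans (cong (v zero i * 1ℚ +_) (lin-null (v ∘ suc ∘ index) (λ _ → refl) i))
                                  (solve 1 (λ x → x :* con 1ℚ :+ con 0ℚ := x) refl (v zero i)))
    spans′ (suc c) i = trans (spans c i) (sym (trans
      (cong (_+ lin (v ∘ suc ∘ index) (coordinates c) i) (ℚₚ.*-zeroʳ (v zero i))) (ℚₚ.+-identityˡ _)))

  absorb : Dependent candidates → Basis v
  absorb (c , candidates·c≗0 , j , cj≢0) with c zero ℚₚ.≟ 0ℚ
  ... | yes c₀≡0 = ⊥-elim (cj≢0 (c≗0 j))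
    where
    rest = lin (v ∘ suc ∘ index) (c ∘ suc)
    c≗0 : Null c
    c≗0 zero    = c₀≡0
    c≗0 (suc a) = independent (c ∘ suc) (λ i → begin
      rest i                     ≡⟨ ℚₚ.+-identityˡ _ ⟨
      0ℚ + rest i                ≡⟨ cong (_+ rest i) (trans (cong (v zero i *_) c₀≡0) (ℚₚ.*-zeroʳ (v zero i))) ⟨
      v zero i * c zero + rest i ≡⟨ candidates·c≗0 i ⟩
      0ℚ                         ∎) a
      where open ≡-Reasoning
  ... | no c₀≢0 = record
    { rank        = rank
    ; index       = suc ∘ index
    ; injective   = injective ∘ Finₚ.suc-injective
    ; independent = independent
    ; coordinates = coordinates′
    ; spans       = spans′
    }
    where
    instance
      c₀-nonZero : ℚ.NonZero (c zero)
      c₀-nonZero = ℚ.≢-nonZero c₀≢0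
    coordinates′ : Fam (suc n) rank
    coordinates′ zero    = λ a → - (1/ c zero) * c (suc a)
    coordinates′ (suc c) = coordinates c
    spans′ : ∀ c → v c ≗ lin (v ∘ suc ∘ index) (coordinates′ c)
    spans′ zero    i = trans
      (solve-linear (c zero) (v zero i) _
        (trans (cong (_+ lin (v ∘ suc ∘ index) (c ∘ suc) i) (ℚₚ.*-comm (c zero) (v zero i))) (candidates·c≗0 i)))
      (sym (lin-scale (v ∘ suc ∘ index) (- (1/ c zero)) (c ∘ suc) i))
    spans′ (suc c) = spans c

basis : ∀ {m} n (v : Fam n m) → Basis v
basis zero    v = record
  { rank = 0 ; index = λ () ; injective = λ { {()} } ; independent = λ _ _ () ; coordinates = λ () ; spans = λ () }
basis {m} (suc n) v with dependent⊎independent m _ (Extend.candidates v (basis n (v ∘ suc)))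
... | inj₁ dep       = Extend.absorb v (basis n (v ∘ suc)) dep
... | inj₂ (ind , _) = Extend.adjoin v (basis n (v ∘ suc)) ind

jointly-injective⇒≤ : ∀ {n k m} (W : Fam k m) (V V′ : Fam n m) (L L′ : Fam n k) →
                      (∀ c → V c ≗ lin W (L c)) → (∀ c → V′ c ≗ lin W (L′ c)) →
                      (∀ q → Null (lin V q) → Null (lin V′ q) → Null q) → n ≤ k ℕ.+ k
jointly-injective⇒≤ {n} {k} W V V′ L L′ V≗WL V′≗WL′ joint = independent⇒≤ Y Y-independent
  where
  Y : Fam n (k ℕ.+ k)
  Y c = L c ++ L′ c

  Y-independent : Independent Y
  Y-independent q Y·q≗0 = joint q
    (λ i → trans (lin-assoc V W L V≗WL q i) (lin-null W L·q≗0 i))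
    (λ i → trans (lin-assoc V′ W L′ V′≗WL′ q i) (lin-null W L′·q≗0 i))
    where
    L·q≗0 : Null (lin L q)
    L·q≗0 a = trans (sum-cong-≗ (λ c → cong (_* q c) (sym (Vecₚ.lookup-++ˡ (L c) (L′ c) a)))) (Y·q≗0 (a ↑ˡ k))
    L′·q≗0 : Null (lin L′ q)
    L′·q≗0 a = trans (sum-cong-≗ (λ c → cong (_* q c) (sym (Vecₚ.lookup-++ʳ (L c) (L′ c) a)))) (Y·q≗0 (k ↑ʳ a))

independent-↑ˡ : ∀ {k d m} (v : Fam (k ℕ.+ d) m) → Independent v → Independent (v ∘ (_↑ˡ d))
independent-↑ˡ {k} {d} v ind y v·y≗0 j = trans (sym (Vecₚ.lookup-++ˡ y (const 0ℚ) j)) (ind y′ v·y′≗0 (j ↑ˡ d))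
  where
  y′ = y ++ const 0ℚ
  v·y′≗0 : Null (lin v y′)
  v·y′≗0 i = begin
    lin v y′ i
      ≡⟨ sum-↑ k (λ j → v j i * y′ j) ⟩
    ∑[ j < k ] (v (j ↑ˡ d) i * y′ (j ↑ˡ d)) + ∑[ j < d ] (v (k ↑ʳ j) i * y′ (k ↑ʳ j))
      ≡⟨ cong₂ _+_ (sum-cong-≗ (λ j → cong (v (j ↑ˡ d) i *_) (Vecₚ.lookup-++ˡ y (const 0ℚ) j)))
                   (sum-null (λ j → trans (cong (v (k ↑ʳ j) i *_) (Vecₚ.lookup-++ʳ y (const 0ℚ) j))
                                          (ℚₚ.*-zeroʳ (v (k ↑ʳ j) i)))) ⟩
    lin (v ∘ (_↑ˡ d)) y i + 0ℚ
      ≡⟨ ℚₚ.+-identityʳ _ ⟩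
    lin (v ∘ (_↑ˡ d)) y i
      ≡⟨ v·y≗0 i ⟩
    0ℚ
      ∎
    where open ≡-Reasoning

columns : ∀ {R C : Set} {m n} → (R → C → ℚ) → (Fin m → R) → (Fin n → C) → Fam n m
columns N row col c i = N (row i) (col c)

rankAtLeast-of-independent : ∀ {R C : Set} {m n K k} (N : R → C → ℚ) (row : Fin m → R) (col : Fin n → C) →
                             Injective _≡_ _≡_ col → (idx : Fin K → Fin n) → Injective _≡_ _≡_ idx →
                             Independent (columns N row col ∘ idx) → k ≤ K → RankAtLeast N k
rankAtLeast-of-independent {k = k} N row col col-inj idx idx-inj ind k≤K with ℕₚ.m≤n⇒∃[o]m+o≡n k≤K
... | d , refl = col ∘ idx ∘ (_↑ˡ d) , distinct , independent
  where
  distinct : ∀ a b → col (idx (a ↑ˡ d)) ≡ col (idx (b ↑ˡ d)) → a ≡ b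
  distinct a b eq = Finₚ.↑ˡ-injective d a b (idx-inj (col-inj eq))
  independent : (y : Fin k → ℚ) → (∀ ρ → Σℚ k (λ j → N ρ (col (idx (j ↑ˡ d))) * y j) ≡ 0ℚ) → ∀ j → y j ≡ 0ℚ
  independent y N·y≡0 = independent-↑ˡ (columns N row col ∘ idx) ind y
    (λ i → trans (sym (Σℚ≡sum k _)) (N·y≡0 (row i)))

-- 2 × 2 matrices acting on K = ℚ²

toVector : K → Vector ℚ 2
toVector (a , b) = a ∷ b ∷ []

toVector-null : ∀ x → Null (toVector x) → x ≡ 0K
toVector-null (a , b) x≗0 = cong₂ _,_ (x≗0 zero) (x≗0 (suc zero))

toVector-ΣK : ∀ r (f : Fin r → K) i → toVector (ΣK r f) i ≡ ∑[ t < r ] toVector (f t) i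
toVector-ΣK zero    f zero       = refl
toVector-ΣK zero    f (suc zero) = refl
toVector-ΣK (suc r) f zero       = cong (proj₁ (f zero) +_) (toVector-ΣK r (f ∘ suc) zero)
toVector-ΣK (suc r) f (suc zero) = cong (proj₂ (f zero) +_) (toVector-ΣK r (f ∘ suc) (suc zero))

ΣK-cong : ∀ r {f g : Fin r → K} → (∀ t → f t ≡ g t) → ΣK r f ≡ ΣK r g
ΣK-cong zero    f≡g = refl
ΣK-cong (suc r) f≡g = cong₂ addK (f≡g zero) (ΣK-cong r (f≡g ∘ suc))

matVec : Mat ℚ 2 2 → K → K
matVec X z = row zero , row (suc zero)
  where
  row : Fin 2 → ℚ
  row i = ∑[ j < 2 ] (X i j * toVector z j)

toVector-matVec : ∀ X z i → toVector (matVec X z) i ≡ ∑[ j < 2 ] (X i j * toVector z j)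
toVector-matVec X z zero       = refl
toVector-matVec X z (suc zero) = refl

matVec-add₂ : ∀ X Y z → matVec (add₂ X Y) z ≡ addK (matVec X z) (matVec Y z)
matVec-add₂ X Y z@(z₀ , z₁) = cong₂ _,_ (entry zero) (entry (suc zero))
  where
  entry : ∀ i → ∑[ j < 2 ] (add₂ X Y i j * toVector z j) ≡
                ∑[ j < 2 ] (X i j * toVector z j) + ∑[ j < 2 ] (Y i j * toVector z j)
  entry i = solve 6 (λ x₀ x₁ y₀ y₁ z₀ z₁ →
      (x₀ :+ y₀) :* z₀ :+ ((x₁ :+ y₁) :* z₁ :+ con 0ℚ)
        := (x₀ :* z₀ :+ (x₁ :* z₁ :+ con 0ℚ)) :+ (y₀ :* z₀ :+ (y₁ :* z₁ :+ con 0ℚ)))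
    refl (X i zero) (X i (suc zero)) (Y i zero) (Y i (suc zero)) z₀ z₁

matVec-mul₂ : ∀ X Y z → matVec (mul₂ X Y) z ≡ matVec X (matVec Y z)
matVec-mul₂ X Y z@(z₀ , z₁) = cong₂ _,_ (entry zero) (entry (suc zero))
  where
  entry : ∀ i → ∑[ j < 2 ] (mul₂ X Y i j * toVector z j) ≡ ∑[ j < 2 ] (X i j * toVector (matVec Y z) j)
  entry i = solve 8 (λ x₀ x₁ y₀₀ y₀₁ y₁₀ y₁₁ z₀ z₁ →
      (x₀ :* y₀₀ :+ (x₁ :* y₁₀ :+ con 0ℚ)) :* z₀ :+ ((x₀ :* y₀₁ :+ (x₁ :* y₁₁ :+ con 0ℚ)) :* z₁ :+ con 0ℚ)
        := x₀ :* (y₀₀ :* z₀ :+ (y₀₁ :* z₁ :+ con 0ℚ)) :+ (x₁ :* (y₁₀ :* z₀ :+ (y₁₁ :* z₁ :+ con 0ℚ)) :+ con 0ℚ))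
    refl (X i zero) (X i (suc zero)) (Y zero zero) (Y zero (suc zero)) (Y (suc zero) zero) (Y (suc zero) (suc zero))
    z₀ z₁

detℚ : Mat ℚ 2 2 → ℚ
detℚ X = X zero zero * X (suc zero) (suc zero) - X zero (suc zero) * X (suc zero) zero

matVec-injective : ∀ X z → detℚ X ≢ 0ℚ → matVec X z ≡ 0K → z ≡ 0K
matVec-injective X z@(z₀ , z₁) det≢0 Xz≡0 =
  cong₂ _,_ (vanishes z₀ x₁₁ x₀₁ y₀ y₁ adjugate₀ y₀≡0 y₁≡0) (vanishes z₁ x₀₀ x₁₀ y₁ y₀ adjugate₁ y₁≡0 y₀≡0)
  where
  x₀₀ = X zero zero
  x₀₁ = X zero (suc zero)
  x₁₀ = X (suc zero) zero
  x₁₁ = X (suc zero) (suc zero)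
  y₀ = proj₁ (matVec X z)
  y₁ = proj₂ (matVec X z)
  y₀≡0 = cong proj₁ Xz≡0
  y₁≡0 = cong proj₂ Xz≡0
  adjugate₀ : detℚ X * z₀ ≡ x₁₁ * y₀ - x₀₁ * y₁
  adjugate₀ = solve 6 (λ x₀₀ x₀₁ x₁₀ x₁₁ z₀ z₁ →
      (x₀₀ :* x₁₁ :- x₀₁ :* x₁₀) :* z₀
        := x₁₁ :* (x₀₀ :* z₀ :+ (x₀₁ :* z₁ :+ con 0ℚ)) :- x₀₁ :* (x₁₀ :* z₀ :+ (x₁₁ :* z₁ :+ con 0ℚ)))
    refl x₀₀ x₀₁ x₁₀ x₁₁ z₀ z₁
  adjugate₁ : detℚ X * z₁ ≡ x₀₀ * y₁ - x₁₀ * y₀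
  adjugate₁ = solve 6 (λ x₀₀ x₀₁ x₁₀ x₁₁ z₀ z₁ →
      (x₀₀ :* x₁₁ :- x₀₁ :* x₁₀) :* z₁
        := x₀₀ :* (x₁₀ :* z₀ :+ (x₁₁ :* z₁ :+ con 0ℚ)) :- x₁₀ :* (x₀₀ :* z₀ :+ (x₀₁ :* z₁ :+ con 0ℚ)))
    refl x₀₀ x₀₁ x₁₀ x₁₁ z₀ z₁
  vanishes : ∀ z u v p q → detℚ X * z ≡ u * p - v * q → p ≡ 0ℚ → q ≡ 0ℚ → z ≡ 0ℚ
  vanishes z u v p q det·z≡ p≡0 q≡0 = *-cancelˡ-nonzero (detℚ X) z det≢0 (begin
    detℚ X * z      ≡⟨ det·z≡ ⟩
    u * p - v * q   ≡⟨ cong₂ (λ p q → u * p - v * q) p≡0 q≡0 ⟩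
    u * 0ℚ - v * 0ℚ ≡⟨ solve 2 (λ u v → u :* con 0ℚ :- v :* con 0ℚ := con 0ℚ) refl u v ⟩
    0ℚ              ∎)
    where open ≡-Reasoning

-- Arithmetic in K = ℚ(√D)

module KPolynomial {k} (d : Polynomial k) where
  infixl 6 _⊕_
  infixl 7 _⊛_

  _⊕_ _⊛_ : Polynomial k × Polynomial k → Polynomial k × Polynomial k → Polynomial k × Polynomial k
  (a , b) ⊕ (c , e) = a :+ c , b :+ e
  (a , b) ⊛ (c , e) = a :* c :+ d :* (b :* e) , a :* e :+ b :* c

module _ (D : ℤ) where
  private
    Dq = ℤtoℚ D

  A-regular : ∀ m z → matVec (A D m) z ≡ mulK D m z
  A-regular (m₀ , m₁) (z₀ , z₁) = cong₂ _,_
    (solve 5 (λ d m₀ m₁ z₀ z₁ →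
        (m₀ :* con 1ℚ :+ m₁ :* con 0ℚ) :* z₀ :+ ((m₀ :* con 0ℚ :+ m₁ :* d) :* z₁ :+ con 0ℚ)
          := m₀ :* z₀ :+ d :* (m₁ :* z₁))
      refl Dq m₀ m₁ z₀ z₁)
    (solve 4 (λ m₀ m₁ z₀ z₁ →
        (m₀ :* con 0ℚ :+ m₁ :* con 1ℚ) :* z₀ :+ ((m₀ :* con 1ℚ :+ m₁ :* con 0ℚ) :* z₁ :+ con 0ℚ)
          := m₀ :* z₁ :+ m₁ :* z₀)
      refl m₀ m₁ z₀ z₁)

  addK-0K-scaled : ∀ σ → addK 0K (mulK D σ 0K) ≡ 0K
  addK-0K-scaled (s₀ , s₁) = cong₂ _,_
    (solve 3 (λ d s₀ s₁ → con 0ℚ :+ (s₀ :* con 0ℚ :+ d :* (s₁ :* con 0ℚ)) := con 0ℚ) refl Dq s₀ s₁)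
    (solve 2 (λ s₀ s₁ → con 0ℚ :+ (s₀ :* con 0ℚ :+ s₁ :* con 0ℚ) := con 0ℚ) refl s₀ s₁)

  ΣK-linear : ∀ r σ (f g : Fin r → K) →
              ΣK r (λ t → addK (f t) (mulK D σ (g t))) ≡ addK (ΣK r f) (mulK D σ (ΣK r g))
  ΣK-linear zero    σ f g = sym (addK-0K-scaled σ)
  ΣK-linear (suc r) σ f g =
    trans (cong (addK (addK (f zero) (mulK D σ (g zero)))) (ΣK-linear r σ (f ∘ suc) (g ∘ suc)))
          (interchange σ (f zero) (g zero) (ΣK r (f ∘ suc)) (ΣK r (g ∘ suc)))
    where
    interchange : ∀ σ a b a′ b′ →
                  addK (addK a (mulK D σ b)) (addK a′ (mulK D σ b′)) ≡ addK (addK a a′) (mulK D σ (addK b b′))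
    interchange (s₀ , s₁) (a₀ , a₁) (b₀ , b₁) (a₀′ , a₁′) (b₀′ , b₁′) = cong₂ _,_
      (solve 11 (λ d s₀ s₁ a₀ a₁ b₀ b₁ a₀′ a₁′ b₀′ b₁′ → let open KPolynomial d in
          proj₁ ((a₀ , a₁) ⊕ (s₀ , s₁) ⊛ (b₀ , b₁) ⊕ ((a₀′ , a₁′) ⊕ (s₀ , s₁) ⊛ (b₀′ , b₁′)))
            := proj₁ ((a₀ , a₁) ⊕ (a₀′ , a₁′) ⊕ (s₀ , s₁) ⊛ ((b₀ , b₁) ⊕ (b₀′ , b₁′))))
        refl Dq s₀ s₁ a₀ a₁ b₀ b₁ a₀′ a₁′ b₀′ b₁′)
      (solve 11 (λ d s₀ s₁ a₀ a₁ b₀ b₁ a₀′ a₁′ b₀′ b₁′ → let open KPolynomial d in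
          proj₂ ((a₀ , a₁) ⊕ (s₀ , s₁) ⊛ (b₀ , b₁) ⊕ ((a₀′ , a₁′) ⊕ (s₀ , s₁) ⊛ (b₀′ , b₁′)))
            := proj₂ ((a₀ , a₁) ⊕ (a₀′ , a₁′) ⊕ (s₀ , s₁) ⊛ ((b₀ , b₁) ⊕ (b₀′ , b₁′))))
        refl Dq s₀ s₁ a₀ a₁ b₀ b₁ a₀′ a₁′ b₀′ b₁′)

  -- With u = B z and y = G z, where B G z = σ√D · B z: m y + m̃ B y − σ√D (m z + m̃ B z) = m (y − σ√D z).
  twist-cancels : ∀ σ m m̃ y z u →
    addK (addK (mulK D m y) (mulK D m̃ (mulK D (0ℚ , σ) u))) (mulK D (0ℚ , - σ) (addK (mulK D m z) (mulK D m̃ u)))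
      ≡ mulK D m (addK y (mulK D (0ℚ , - σ) z))
  twist-cancels σ (m₀ , m₁) (n₀ , n₁) (y₀ , y₁) (z₀ , z₁) (u₀ , u₁) = cong₂ _,_
    (solve 12 (λ d σ m₀ m₁ n₀ n₁ y₀ y₁ z₀ z₁ u₀ u₁ → let open KPolynomial d in
        proj₁ ((m₀ , m₁) ⊛ (y₀ , y₁) ⊕ (n₀ , n₁) ⊛ ((con 0ℚ , σ) ⊛ (u₀ , u₁))
                 ⊕ (con 0ℚ , :- σ) ⊛ ((m₀ , m₁) ⊛ (z₀ , z₁) ⊕ (n₀ , n₁) ⊛ (u₀ , u₁)))
          := proj₁ ((m₀ , m₁) ⊛ ((y₀ , y₁) ⊕ (con 0ℚ , :- σ) ⊛ (z₀ , z₁))))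
      refl Dq σ m₀ m₁ n₀ n₁ y₀ y₁ z₀ z₁ u₀ u₁)
    (solve 12 (λ d σ m₀ m₁ n₀ n₁ y₀ y₁ z₀ z₁ u₀ u₁ → let open KPolynomial d in
        proj₂ ((m₀ , m₁) ⊛ (y₀ , y₁) ⊕ (n₀ , n₁) ⊛ ((con 0ℚ , σ) ⊛ (u₀ , u₁))
                 ⊕ (con 0ℚ , :- σ) ⊛ ((m₀ , m₁) ⊛ (z₀ , z₁) ⊕ (n₀ , n₁) ⊛ (u₀ , u₁)))
          := proj₂ ((m₀ , m₁) ⊛ ((y₀ , y₁) ⊕ (con 0ℚ , :- σ) ⊛ (z₀ , z₁))))
      refl Dq σ m₀ m₁ n₀ n₁ y₀ y₁ z₀ z₁ u₀ u₁)

-- Integer polynomials and their images in ℚ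

ℤtoℚ-unnormalised : ∀ z → ℚ.toℚᵘ (ℤtoℚ z) ≃ᵘ mkℚᵘ z 0
ℤtoℚ-unnormalised z = ℚₚ.toℚᵘ-fromℚᵘ (mkℚᵘ z 0)

module _ where
  open ℚᵘₚ.≃-Reasoning

  ℤtoℚ-+ : ∀ a b → ℤtoℚ (a ℤ.+ b) ≡ ℤtoℚ a + ℤtoℚ b
  ℤtoℚ-+ a b = ℚₚ.toℚᵘ-injective (begin
    ℚ.toℚᵘ (ℤtoℚ (a ℤ.+ b))              ≈⟨ ℤtoℚ-unnormalised (a ℤ.+ b) ⟩
    mkℚᵘ (a ℤ.+ b) 0                     ≈⟨ *≡* (trans (ℤₚ.*-identityʳ _) (sym (trans (ℤₚ.*-identityʳ _)
                                              (cong₂ ℤ._+_ (ℤₚ.*-identityʳ a) (ℤₚ.*-identityʳ b))))) ⟩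
    mkℚᵘ a 0 ℚᵘ.+ mkℚᵘ b 0               ≈⟨ ℚᵘₚ.+-cong (ℤtoℚ-unnormalised a) (ℤtoℚ-unnormalised b) ⟨
    ℚ.toℚᵘ (ℤtoℚ a) ℚᵘ.+ ℚ.toℚᵘ (ℤtoℚ b) ≈⟨ ℚₚ.toℚᵘ-homo-+ (ℤtoℚ a) (ℤtoℚ b) ⟨
    ℚ.toℚᵘ (ℤtoℚ a + ℤtoℚ b)             ∎)

  ℤtoℚ-* : ∀ a b → ℤtoℚ (a ℤ.* b) ≡ ℤtoℚ a * ℤtoℚ b
  ℤtoℚ-* a b = ℚₚ.toℚᵘ-injective (begin
    ℚ.toℚᵘ (ℤtoℚ (a ℤ.* b))              ≈⟨ ℤtoℚ-unnormalised (a ℤ.* b) ⟩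
    mkℚᵘ (a ℤ.* b) 0                     ≈⟨ *≡* refl ⟩
    mkℚᵘ a 0 ℚᵘ.* mkℚᵘ b 0               ≈⟨ ℚᵘₚ.*-cong (ℤtoℚ-unnormalised a) (ℤtoℚ-unnormalised b) ⟨
    ℚ.toℚᵘ (ℤtoℚ a) ℚᵘ.* ℚ.toℚᵘ (ℤtoℚ b) ≈⟨ ℚₚ.toℚᵘ-homo-* (ℤtoℚ a) (ℤtoℚ b) ⟨
    ℚ.toℚᵘ (ℤtoℚ a * ℤtoℚ b)             ∎)

  ℤtoℚ-neg : ∀ a → ℤtoℚ (ℤ.- a) ≡ - ℤtoℚ a
  ℤtoℚ-neg a = ℚₚ.toℚᵘ-injective (begin
    ℚ.toℚᵘ (ℤtoℚ (ℤ.- a))                ≈⟨ ℤtoℚ-unnormalised (ℤ.- a) ⟩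
    mkℚᵘ (ℤ.- a) 0                       ≈⟨ *≡* refl ⟩
    ℚᵘ.- mkℚᵘ a 0                        ≈⟨ ℚᵘₚ.-‿cong (ℤtoℚ-unnormalised a) ⟨
    ℚᵘ.- ℚ.toℚᵘ (ℤtoℚ a)                 ≈⟨ ℚₚ.toℚᵘ-homo‿- (ℤtoℚ a) ⟨
    ℚ.toℚᵘ (- ℤtoℚ a)                    ∎)

  ℤtoℚ-≢0 : ∀ {z} → z ≢ 0ℤ → ℤtoℚ z ≢ 0ℚ
  ℤtoℚ-≢0 {z} z≢0 eq with ℚᵘₚ.≃-trans (ℚᵘₚ.≃-sym (ℤtoℚ-unnormalised z)) (ℚᵘₚ.≃-reflexive (cong ℚ.toℚᵘ eq))
  ... | *≡* z*1≡0 = z≢0 (trans (sym (ℤₚ.*-identityʳ z)) z*1≡0)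

infixl 6 _‵+_
infixl 7 _‵*_
infix  8 ‵-_ ‵_

data ℤExpr : Set where
  ‵_        : ℤ → ℤExpr
  _‵+_ _‵*_ : ℤExpr → ℤExpr → ℤExpr
  ‵-_       : ℤExpr → ℤExpr

⟦_⟧ℤ : ℤExpr → ℤ
⟦ ‵ z    ⟧ℤ = z
⟦ x ‵+ y ⟧ℤ = ⟦ x ⟧ℤ ℤ.+ ⟦ y ⟧ℤ
⟦ x ‵* y ⟧ℤ = ⟦ x ⟧ℤ ℤ.* ⟦ y ⟧ℤ
⟦ ‵- x   ⟧ℤ = ℤ.- ⟦ x ⟧ℤ

⟦_⟧ℚ : ℤExpr → ℚ
⟦ ‵ z    ⟧ℚ = ℤtoℚ z
⟦ x ‵+ y ⟧ℚ = ⟦ x ⟧ℚ + ⟦ y ⟧ℚ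
⟦ x ‵* y ⟧ℚ = ⟦ x ⟧ℚ * ⟦ y ⟧ℚ
⟦ ‵- x   ⟧ℚ = - ⟦ x ⟧ℚ

ℤtoℚ-⟦⟧ : ∀ x → ℤtoℚ ⟦ x ⟧ℤ ≡ ⟦ x ⟧ℚ
ℤtoℚ-⟦⟧ (‵ z)    = refl
ℤtoℚ-⟦⟧ (x ‵+ y) = trans (ℤtoℚ-+ ⟦ x ⟧ℤ ⟦ y ⟧ℤ) (cong₂ _+_ (ℤtoℚ-⟦⟧ x) (ℤtoℚ-⟦⟧ y))
ℤtoℚ-⟦⟧ (x ‵* y) = trans (ℤtoℚ-* ⟦ x ⟧ℤ ⟦ y ⟧ℤ) (cong₂ _*_ (ℤtoℚ-⟦⟧ x) (ℤtoℚ-⟦⟧ y))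
ℤtoℚ-⟦⟧ (‵- x)   = trans (ℤtoℚ-neg ⟦ x ⟧ℤ) (cong -_ (ℤtoℚ-⟦⟧ x))

square : ∀ i → i ℤ.* i ≡ ℤ.+ (ℤ.∣ i ∣ ℕ.* ℤ.∣ i ∣)
square (ℤ.+ n)  = sym (ℤₚ.pos-* n n)
square -[1+ n ] = refl

κ-positive : ∀ n k S T → ∃ λ w →
             S ℤ.* S ℤ.- -[1+ n ] ℤ.* (T ℤ.* T) ℤ.+ -[1+ n ] ℤ.* -[1+ k ] ℤ.* ℤ.+ 4 ≡ ℤ.+ suc w
κ-positive n k S T = _ , trans
  (cong₂ (λ x y → x ℤ.+ y ℤ.+ -[1+ n ] ℤ.* -[1+ k ] ℤ.* ℤ.+ 4) (square S)
    (trans (ℤₚ.neg-distribˡ-* -[1+ n ] (T ℤ.* T)) (trans (cong (+[1+ n ] ℤ.*_) (square T)) (sym (ℤₚ.pos-* (suc n) _)))))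
  (cong ℤ.+_ (ℕₚ.+-suc _ _))

δκ≢0 : ∀ {D δ} S T → D < 0ℤ → δ < 0ℤ → ℤ.- (δ ℤ.* (S ℤ.* S ℤ.- D ℤ.* (T ℤ.* T) ℤ.+ D ℤ.* δ ℤ.* ℤ.+ 4)) ≢ 0ℤ
δκ≢0 {ℤ.+ _}                 _ _ (ℤ.+<+ ()) _
δκ≢0 { -[1+ _ ]} {ℤ.+ _}      _ _ _          (ℤ.+<+ ())
δκ≢0 { -[1+ n ]} { -[1+ k ]} S T _ _ with κ-positive n k S T
... | _ , κ≡+suc = subst (λ κ → ℤ.- (-[1+ k ] ℤ.* κ) ≢ 0ℤ) (sym κ≡+suc) (λ ())

-- The matrices G and Λ

module Intertwiner (D : ℤ) (B : Mat ℤ 2 2) where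
  private
    Dq = ℤtoℚ D
    a = toℚMat B zero zero
    b = toℚMat B zero (suc zero)
    c = toℚMat B (suc zero) zero
    d = toℚMat B (suc zero) (suc zero)

  δ : ℚ
  δ = a * d - b * c

  -- G = adj(B) A_D B
  G : Mat ℚ 2 2
  G zero       zero       = Dq * (c * d) - a * b
  G zero       (suc zero) = Dq * (d * d) - b * b
  G (suc zero) zero       = a * a - Dq * (c * c)
  G (suc zero) (suc zero) = a * b - Dq * (c * d)

  Λ : Mat ℚ 2 2
  Λ zero       zero       = G zero zero
  Λ zero       (suc zero) = G zero (suc zero) - Dq * δ
  Λ (suc zero) zero       = G (suc zero) zero - δ
  Λ (suc zero) (suc zero) = G (suc zero) (suc zero)

  B∘G : ∀ z → matVec (toℚMat B) (matVec G z) ≡ mulK D (0ℚ , δ) (matVec (toℚMat B) z)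
  B∘G (z₀ , z₁) = cong₂ _,_
    (solve 7 (λ D a b c d z₀ z₁ →
        a :* ((D :* (c :* d) :- a :* b) :* z₀ :+ ((D :* (d :* d) :- b :* b) :* z₁ :+ con 0ℚ))
          :+ (b :* ((a :* a :- D :* (c :* c)) :* z₀ :+ ((a :* b :- D :* (c :* d)) :* z₁ :+ con 0ℚ)) :+ con 0ℚ)
        := con 0ℚ :* (a :* z₀ :+ (b :* z₁ :+ con 0ℚ)) :+ D :* ((a :* d :- b :* c) :* (c :* z₀ :+ (d :* z₁ :+ con 0ℚ))))
      refl Dq a b c d z₀ z₁)
    (solve 7 (λ D a b c d z₀ z₁ →
        c :* ((D :* (c :* d) :- a :* b) :* z₀ :+ ((D :* (d :* d) :- b :* b) :* z₁ :+ con 0ℚ))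
          :+ (d :* ((a :* a :- D :* (c :* c)) :* z₀ :+ ((a :* b :- D :* (c :* d)) :* z₁ :+ con 0ℚ)) :+ con 0ℚ)
        := con 0ℚ :* (c :* z₀ :+ (d :* z₁ :+ con 0ℚ)) :+ (a :* d :- b :* c) :* (a :* z₀ :+ (b :* z₁ :+ con 0ℚ)))
      refl Dq a b c d z₀ z₁)

  matVec-Λ : ∀ z → matVec Λ z ≡ addK (matVec G z) (mulK D (0ℚ , - δ) z)
  matVec-Λ (z₀ , z₁) = cong₂ _,_
    (solve 6 (λ D δ g₀₀ g₀₁ z₀ z₁ →
        g₀₀ :* z₀ :+ ((g₀₁ :- D :* δ) :* z₁ :+ con 0ℚ)
          := (g₀₀ :* z₀ :+ (g₀₁ :* z₁ :+ con 0ℚ)) :+ (con 0ℚ :* z₀ :+ D :* (:- δ :* z₁)))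
      refl Dq δ (G zero zero) (G zero (suc zero)) z₀ z₁)
    (solve 5 (λ δ g₁₀ g₁₁ z₀ z₁ →
        (g₁₀ :- δ) :* z₀ :+ (g₁₁ :* z₁ :+ con 0ℚ)
          := (g₁₀ :* z₀ :+ (g₁₁ :* z₁ :+ con 0ℚ)) :+ (con 0ℚ :* z₁ :+ :- δ :* z₀))
      refl δ (G (suc zero) zero) (G (suc zero) (suc zero)) z₀ z₁)

  δE SE TE κE : ℤExpr
  δE = ‵ B zero zero ‵* ‵ B (suc zero) (suc zero) ‵+ ‵- (‵ B zero (suc zero) ‵* ‵ B (suc zero) zero)
  SE = ‵ B zero (suc zero) ‵+ ‵ D ‵* ‵ B (suc zero) zero
  TE = ‵ B zero zero ‵+ ‵ B (suc zero) (suc zero)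
  κE = SE ‵* SE ‵+ ‵- (‵ D ‵* (TE ‵* TE)) ‵+ ‵ D ‵* δE ‵* ‵ ℤ.+ 4

  det-Λ : detℚ Λ ≡ ⟦ ‵- (δE ‵* κE) ⟧ℚ
  det-Λ = solve 5 (λ D a b c d → let δ = a :* d :- b :* c in
      (D :* (c :* d) :- a :* b) :* (a :* b :- D :* (c :* d))
        :- (D :* (d :* d) :- b :* b :- D :* δ) :* (a :* a :- D :* (c :* c) :- δ)
      := :- (δ :* ((b :+ D :* c) :* (b :+ D :* c) :+ :- (D :* ((a :+ d) :* (a :+ d)))
                   :+ D :* δ :* con (ℤtoℚ (ℤ.+ 4)))))
    refl Dq a b c d

  det-Λ≢0 : D < 0ℤ → det₂ B < 0ℤ → detℚ Λ ≢ 0ℚ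
  det-Λ≢0 D<0 detB<0 detΛ≡0 = ℤtoℚ-≢0 (δκ≢0 ⟦ SE ⟧ℤ ⟦ TE ⟧ℤ D<0 detB<0)
    (trans (ℤtoℚ-⟦⟧ (‵- (δE ‵* κE))) (trans (sym det-Λ) detΛ≡0))

-- Block matrices and M̂

remQuot-injective : ∀ {m} n → Injective _≡_ _≡_ (remQuot {m} n)
remQuot-injective {m} n {x} {y} eq =
  trans (sym (Finₚ.combine-remQuot {m} n x)) (trans (cong (uncurry combine) eq) (Finₚ.combine-remQuot {m} n y))

blockMatrix : ∀ {e r} → (Fin e → Fin r → Mat ℚ 2 2) → Fin e × Fin 2 → Fin r × Fin 2 → ℚ
blockMatrix X (s , i) (t , j) = X s t i j

blockColumns : ∀ {e r} → (Fin e → Fin r → Mat ℚ 2 2) → Fam (r ℕ.* 2) (e ℕ.* 2)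
blockColumns X = columns (blockMatrix X) (remQuot 2) (remQuot 2)

blockOf : ∀ {r} → Vector ℚ (r ℕ.* 2) → Fin r → K
blockOf {r} q t = q (combine {r} t zero) , q (combine {r} t (suc zero))

toVector-blockOf : ∀ {r} (q : Vector ℚ (r ℕ.* 2)) t j → q (combine {r} t j) ≡ toVector (blockOf q t) j
toVector-blockOf q t zero       = refl
toVector-blockOf q t (suc zero) = refl

lin-blockColumns : ∀ {e r} (X : Fin e → Fin r → Mat ℚ 2 2) q s i →
                   lin (blockColumns X) q (combine s i) ≡ toVector (ΣK r (λ t → matVec (X s t) (blockOf q t))) i
lin-blockColumns {e} {r} X q s i = begin
  ∑[ c < r ℕ.* 2 ] (blockMatrix X (remQuot {e} 2 (combine s i)) (remQuot {r} 2 c) * q c)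
    ≡⟨ cong (λ ρ → ∑[ c < r ℕ.* 2 ] (blockMatrix X ρ (remQuot {r} 2 c) * q c)) (Finₚ.remQuot-combine s i) ⟩
  ∑[ c < r ℕ.* 2 ] (blockMatrix X (s , i) (remQuot {r} 2 c) * q c)
    ≡⟨ sum-combine r (λ c → blockMatrix X (s , i) (remQuot {r} 2 c) * q c) ⟩
  ∑[ t < r ] ∑[ j < 2 ] (blockMatrix X (s , i) (remQuot {r} 2 (combine t j)) * q (combine t j))
    ≡⟨ sum-cong-≗ (λ t → sum-cong-≗ (λ j →
         cong₂ (λ κ x → blockMatrix X (s , i) κ * x) (Finₚ.remQuot-combine t j) (toVector-blockOf {r} q t j))) ⟩
  ∑[ t < r ] ∑[ j < 2 ] (X s t i j * toVector (blockOf q t) j)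
    ≡⟨ sum-cong-≗ (λ t → toVector-matVec (X s t) (blockOf q t) i) ⟨
  ∑[ t < r ] toVector (matVec (X s t) (blockOf q t)) i
    ≡⟨ toVector-ΣK r (λ t → matVec (X s t) (blockOf q t)) i ⟨
  toVector (ΣK r (λ t → matVec (X s t) (blockOf q t))) i
    ∎
  where open ≡-Reasoning

ΣK-blocks-null : ∀ {e r} (X : Fin e → Fin r → Mat ℚ 2 2) q → Null (lin (blockColumns X) q) →
                 ∀ s → ΣK r (λ t → matVec (X s t) (blockOf q t)) ≡ 0K
ΣK-blocks-null X q X·q≗0 s =
  toVector-null _ (λ i → trans (sym (lin-blockColumns X q s i)) (X·q≗0 (combine s i)))

blockColumns-mul₂ : ∀ {e r} (X : Fin e → Fin r → Mat ℚ 2 2) Y c →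
                    let (t , j) = remQuot {r} 2 c in
                    blockColumns (λ s t → mul₂ (X s t) Y) c ≗ lin (blockColumns X ∘ combine t) (λ k → Y k j)
blockColumns-mul₂ {e} {r} X Y c i = sym (sum-cong-≗ (λ k →
  cong (λ κ → blockMatrix X (remQuot {e} 2 i) κ * Y k j) (Finₚ.remQuot-combine t k)))
  where
  t = proj₁ (remQuot {r} 2 c)
  j = proj₂ (remQuot {r} 2 c)

module MHat (D : ℤ) {e r : ℕ} (M M~ : Mat K e r) (B : Mat ℤ 2 2) where
  open Intertwiner D B

  Â : Fin e → Fin r → Mat ℚ 2 2
  Â s t = add₂ (A D (M s t)) (mul₂ (A D (M~ s t)) (toℚMat B))

  matVec-Â : ∀ s t z → matVec (Â s t) z ≡ addK (mulK D (M s t) z) (mulK D (M~ s t) (matVec (toℚMat B) z))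
  matVec-Â s t z = trans (matVec-add₂ (A D (M s t)) (mul₂ (A D (M~ s t)) (toℚMat B)) z)
    (cong₂ addK (A-regular D (M s t) z) (trans (matVec-mul₂ (A D (M~ s t)) (toℚMat B) z) (A-regular D (M~ s t) _)))

  Â-twist : ∀ s t z →
            addK (matVec (Â s t) (matVec G z)) (mulK D (0ℚ , - δ) (matVec (Â s t) z)) ≡ mulK D (M s t) (matVec Λ z)
  Â-twist s t z = begin
    addK (matVec (Â s t) (matVec G z)) (mulK D σ (matVec (Â s t) z))
      ≡⟨ cong₂ (λ x y → addK x (mulK D σ y)) (matVec-Â s t (matVec G z)) (matVec-Â s t z) ⟩
    addK (addK (mulK D m (matVec G z)) (mulK D m̃ (matVec Bq (matVec G z)))) (mulK D σ (F z))
      ≡⟨ cong (λ x → addK (addK (mulK D m (matVec G z)) (mulK D m̃ x)) (mulK D σ (F z))) (B∘G z) ⟩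
    addK (addK (mulK D m (matVec G z)) (mulK D m̃ (mulK D (0ℚ , δ) (matVec Bq z)))) (mulK D σ (F z))
      ≡⟨ twist-cancels D δ m m̃ (matVec G z) z (matVec Bq z) ⟩
    mulK D m (addK (matVec G z) (mulK D σ z))
      ≡⟨ cong (mulK D m) (matVec-Λ z) ⟨
    mulK D m (matVec Λ z)
      ∎
    where
    open ≡-Reasoning
    m = M s t
    m̃ = M~ s t
    Bq = toℚMat B
    σ = 0ℚ , - δ
    F = λ z → addK (mulK D m z) (mulK D m̃ (matVec Bq z))

  N N′ : Fam (r ℕ.* 2) (e ℕ.* 2)
  N  = blockColumns Â
  N′ = blockColumns (λ s t → mul₂ (Â s t) G)

  module _ (full : HasFullColumnRankK D M) (D<0 : D < 0ℤ) (detB<0 : det₂ B < 0ℤ) where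

    kernel-trivial : (w : Fin r → K) →
                     (∀ s → ΣK r (λ t → matVec (Â s t) (w t)) ≡ 0K) →
                     (∀ s → ΣK r (λ t → matVec (Â s t) (matVec G (w t))) ≡ 0K) → ∀ t → w t ≡ 0K
    kernel-trivial w Â·w≡0 ÂG·w≡0 t =
      matVec-injective Λ (w t) (det-Λ≢0 D<0 detB<0) (full (λ t → matVec Λ (w t)) M·Λw≡0 t)
      where
      σ = 0ℚ , - δ
      M·Λw≡0 : ∀ s → ΣK r (λ t → mulK D (M s t) (matVec Λ (w t))) ≡ 0K
      M·Λw≡0 s = begin
        ΣK r (λ t → mulK D (M s t) (matVec Λ (w t)))
          ≡⟨ ΣK-cong r (λ t → Â-twist s t (w t)) ⟨
        ΣK r (λ t → addK (matVec (Â s t) (matVec G (w t))) (mulK D σ (matVec (Â s t) (w t))))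
          ≡⟨ ΣK-linear D r σ _ _ ⟩
        addK (ΣK r (λ t → matVec (Â s t) (matVec G (w t)))) (mulK D σ (ΣK r (λ t → matVec (Â s t) (w t))))
          ≡⟨ cong₂ (λ x y → addK x (mulK D σ y)) (ÂG·w≡0 s) (Â·w≡0 s) ⟩
        addK 0K (mulK D σ 0K)
          ≡⟨ addK-0K-scaled D σ ⟩
        0K
          ∎
        where open ≡-Reasoning

    N-N′-jointly-injective : ∀ q → Null (lin N q) → Null (lin N′ q) → Null q
    N-N′-jointly-injective q N·q≗0 N′·q≗0 c = begin
      q c                      ≡⟨ cong q (Finₚ.combine-remQuot {r} 2 c) ⟨
      q (combine t j)          ≡⟨ toVector-blockOf q t j ⟩
      toVector (blockOf q t) j ≡⟨ cong (λ x → toVector x j) (blocks≡0 t) ⟩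
      toVector 0K j            ≡⟨ toVector-0K j ⟩
      0ℚ                       ∎
      where
      open ≡-Reasoning
      t = proj₁ (remQuot {r} 2 c)
      j = proj₂ (remQuot {r} 2 c)
      toVector-0K : Null (toVector 0K)
      toVector-0K zero       = refl
      toVector-0K (suc zero) = refl
      blocks≡0 : ∀ t → blockOf q t ≡ 0K
      blocks≡0 = kernel-trivial (blockOf q) (ΣK-blocks-null Â q N·q≗0) (λ s →
        trans (ΣK-cong r (λ t → sym (matVec-mul₂ (Â s t) G (blockOf q t))))
              (ΣK-blocks-null (λ s t → mul₂ (Â s t) G) q N′·q≗0 s))

    r≤rank : (b : Basis N) → r ≤ Basis.rank b
    r≤rank b = ℕₚ.*-cancelʳ-≤ r rank 2 (subst (r ℕ.* 2 ≤_) rank+rank≡rank*2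
      (jointly-injective⇒≤ (N ∘ index) N N′ coordinates L′ spans N′-spans N-N′-jointly-injective))
      where
      open Basis b
      rank+rank≡rank*2 : rank ℕ.+ rank ≡ rank ℕ.* 2
      rank+rank≡rank*2 = trans (cong (rank ℕ.+_) (sym (ℕₚ.+-identityʳ rank))) (ℕₚ.*-comm 2 rank)
      L′ : Fam (r ℕ.* 2) rank
      L′ c = lin (coordinates ∘ combine (proj₁ (remQuot {r} 2 c))) (λ k → G k (proj₂ (remQuot {r} 2 c)))
      N′-spans : ∀ c → N′ c ≗ lin (N ∘ index) (L′ c)
      N′-spans c i = trans (blockColumns-mul₂ Â G c i)
        (lin-assoc (N ∘ combine t) (N ∘ index) (coordinates ∘ combine t) (spans ∘ combine t) (λ k → G k j) i)
        where
        t = proj₁ (remQuot {r} 2 c)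
        j = proj₂ (remQuot {r} 2 c)

lemma1 : (D : ℤ) → D < 0ℤ → (e r : ℕ) → (M M~ : Mat K e r) → HasFullColumnRankK D M
    → (B : Mat ℤ 2 2) → det₂ B < 0ℤ → RankAtLeast (Mhat D M M~ B) r
lemma1 D D<0 e r M M~ full B detB<0 =
  rankAtLeast-of-independent (Mhat D M M~ B) (remQuot 2) (remQuot 2) (remQuot-injective 2)
    index injective independent (r≤rank full D<0 detB<0 b)
  where
  open MHat D M M~ B
  b = basis (r ℕ.* 2) N
  open Basis b
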